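{- Fix integers $n \ge 1$ and $m \ge 1$. For every $(n, m)$-multiplicative type $\tau$, every integer $k \ge 2$ and every coloring $\chi : \mathrm{Emb}_\tau(n, \omega \cdot m) \to k$ there is an infinite $U \subseteq \omega$ such that $|\chi(\mathrm{Emb}_\tau(n, U \cdot m))| = 1$.
   Context: For a chain $C$ and finite chain $n=\{0<\dots<n-1\}$, $\mathrm{Emb}(n,C)$ is the set of order embeddings $n\hookrightarrow C$; $k=\{0,\dots,k-1\}$. $\omega\cdot m$ is $\omega\times m$ ordered antilexicographically: $(a,\ell)<(b,\ell')$ iff $\ell<\ell'$, or $\ell=\ell'$ and $a<b$; for $U\subseteq\omega$, $U\cdot m=U\times m$ as a subchain. For $f\in\mathrm{Emb}(n,\omega\cdot m)$ write $f(i)=(\pi_0(f(i)),\pi_1(f(i)))$. The multiplicative type of $f$ is $\mathrm{tp}(f)=(p_0,\dots,p_{m-1},\sigma)$ where $p_\ell=|\{i<n:\pi_1(f(i))=\ell\}|$ and $\sigma$ is the total quasiorder on $n$ given by $(i,j)\in\sigma$ iff $\pi_0(f(i))\le\pi_0(f(j))$. An $(n,m)$-multiplicative type is any tuple of the form $\mathrm{tp}(f)$ for some such $f$. $\mathrm{Emb}_\tau(n,\omega\cdot m)=\{f:\mathrm{tp}(f)=\tau\}$, and similarly for $U\cdot m$. -}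

module Defs where

open import Data.Nat using (ℕ; _≤_; _<_)
open import Data.Fin as Fin using (Fin; toℕ)
open import Data.Fin.Properties using () renaming (_≟_ to _≟ᶠ_)
open import Data.Nat.Properties using () renaming (_≤?_ to _≤ℕ?_)
open import Data.Vec using (Vec; lookup; tabulate; count; map)
open import Data.Bool using (Bool)
open import Data.Product using (_×_; _,_; proj₁; proj₂; ∃-syntax)
open import Data.Sum using (_⊎_)
open import Function.Bundles using (_⇔_)
open import Relation.Binary.PropositionalEquality using (_≡_)
open import Relation.Nullary.Decidable using (⌊_⌋)
open import Relation.Unary using (Pred; _∈_)
open import Level using (0ℓ)

-- The chain ω·m : elements (a , ℓ) with a ∈ ℕ (= ω) and ℓ ∈ Fin m,
-- ordered antilexicographically.
Ωm : ℕ → Set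
Ωm m = ℕ × Fin m

π₀ : ∀ {m} → Ωm m → ℕ
π₀ = proj₁

π₁ : ∀ {m} → Ωm m → Fin m
π₁ = proj₂

_≤ω_ : ∀ {m} → Ωm m → Ωm m → Set
(a , ℓ) ≤ω (b , ℓ') = (toℕ ℓ < toℕ ℓ') ⊎ ((ℓ ≡ ℓ') × (a ≤ b))

Map : ℕ → ℕ → Set
Map n m = Vec (Ωm m) n

IsEmb : ∀ {n m} → Map n m → Set
IsEmb {n} f = ∀ (i j : Fin n) → (toℕ i ≤ toℕ j) ⇔ (lookup f i ≤ω lookup f j)

-- Multiplicative types: (p_0,…,p_{m-1}, σ), with σ given by its
-- characteristic matrix  σ[i][j] = true iff (i,j) ∈ σ.
MultType : ℕ → ℕ → Set
MultType n m = Vec ℕ m × Vec (Vec Bool n) n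

tp : ∀ {n m} → Map n m → MultType n m
tp {n} {m} f =
  ( tabulate (λ ℓ → count (λ x → π₁ x ≟ᶠ ℓ) f)
  , tabulate (λ i → tabulate (λ j → ⌊ π₀ (lookup f i) ≤ℕ? π₀ (lookup f j) ⌋)) )

IsMultType : ∀ {n m} → MultType n m → Set
IsMultType {n} {m} τ = ∃[ f ] (IsEmb {n} {m} f × tp f ≡ τ)

InEmbτU : ∀ {n m} → MultType n m → Pred ℕ 0ℓ → Map n m → Set
InEmbτU {n} {m} τ U f =
  IsEmb f × tp f ≡ τ × (∀ (i : Fin n) → π₀ (lookup f i) ∈ U)

Infinite : Pred ℕ 0ℓ → Set
Infinite U = ∀ (N : ℕ) → ∃[ u ] (N ≤ u × u ∈ U)

-- Embeddings of the same multiplicative type share the order pattern of their first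
-- coordinates and the level of every point, so it suffices to find, for every map z, an
-- infinite U on which the colouring is constant on the maps with values in U and the
-- shape of z. This is a Ramsey argument by induction on the number of points: if the
-- least first coordinate of z is repeated, that point is determined by the others; if it
-- is strict, pick a₀ < a₁ < … inside nested infinite sets homogeneous for the colouring
-- with that point sent to aᵢ, and keep the aᵢ of one colour occurring infinitely often.
-- Emb_τ(n, U·m) is nonempty: compose any embedding of type τ with the enumeration of U.
module Submission where

open import Defs
open import Data.Nat using (ℕ; zero; suc; _≤_; _<_; _≥_; _≮_; z≤n; s≤s; _⊔_)
open import Data.Nat.Properties
  using (≤-refl; ≤-trans; <-trans; ≤-antisym; ≤-reflexive; <⇒≤; <⇒≱; ≰⇒>; ≮⇒≥; ≤∧≢⇒<;
         <-irrefl; ≤-pred; ≤-<-trans; <-≤-trans; <-cmp; m≤m⊔n; m≤n⊔m; m≤n⇒m<n∨m≡n; m<1+n⇒m<n∨m≡n;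
         suc-injective; 1+n≢0)
  renaming (_≟_ to _≟ℕ_; _≤?_ to _≤ℕ?_)
open import Data.Fin as Fin using (Fin; toℕ; punchIn; punchOut)
open import Data.Fin.Properties using (toℕ-injective; punchInᵢ≢i; any?) renaming (_≟_ to _≟ᶠ_)
open import Data.Vec using (Vec; []; _∷_; lookup; count; map; insertAt; removeAt)
open import Data.Vec.Properties
  using (lookup∘tabulate; tabulate-cong; lookup-map; insertAt-punchIn; insertAt-removeAt;
         removeAt-punchOut)
open import Data.Bool using (if_then_else_)
open import Data.Product using (_×_; _,_; proj₁; proj₂; ∃-syntax; Σ)
open import Data.Sum using (_⊎_; inj₁; inj₂)
open import Data.Empty using (⊥-elim)
open import Data.Unit using (⊤; tt)
open import Function using (id; _∘_)
open import Function.Bundles using (_⇔_; mk⇔; Equivalence)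
open import Relation.Binary.PropositionalEquality
open import Relation.Binary.Definitions using (tri<; tri≈; tri>)
open import Relation.Nullary using (Dec; yes; no; ¬_; does)
open import Relation.Nullary.Decidable using (⌊_⌋; ¬?; _×-dec_)
open import Relation.Unary using (Pred; _∈_; _⊆_; _∪_)
open import Level using (0ℓ)
open import Axiom.ExcludedMiddle using (ExcludedMiddle)

open Equivalence using (to; from)

private
  variable
    n m k : ℕ

-- tp is stated with ⌊_⌋, which unlike does computes only once the Dec is a yes or a no.
⌊⌋-≡⇒⇔ : ∀ {A B : Set} (a? : Dec A) (b? : Dec B) → ⌊ a? ⌋ ≡ ⌊ b? ⌋ → A ⇔ B
⌊⌋-≡⇒⇔ (yes a) (yes b) _ = mk⇔ (λ _ → b) (λ _ → a)
⌊⌋-≡⇒⇔ (no ¬a) (no ¬b) _ = mk⇔ (⊥-elim ∘ ¬a) (⊥-elim ∘ ¬b)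

⇔⇒⌊⌋-≡ : ∀ {A B : Set} (a? : Dec A) (b? : Dec B) → A ⇔ B → ⌊ a? ⌋ ≡ ⌊ b? ⌋
⇔⇒⌊⌋-≡ (yes a) (yes b) _ = refl
⇔⇒⌊⌋-≡ (yes a) (no ¬b) A⇔B = ⊥-elim (¬b (to A⇔B a))
⇔⇒⌊⌋-≡ (no ¬a) (yes b) A⇔B = ⊥-elim (¬a (from A⇔B b))
⇔⇒⌊⌋-≡ (no ¬a) (no ¬b) _ = refl

count-map : ∀ {A B : Set} {P : Pred B 0ℓ} (P? : ∀ b → Dec (P b)) (f : A → B) (xs : Vec A n) →
  count P? (map f xs) ≡ count (P? ∘ f) xs
count-map P? f [] = refl
count-map P? f (x ∷ xs) = cong (if does (P? (f x)) then suc else id) (count-map P? f xs)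

lookup-removeAt : ∀ {A : Set} (xs : Vec A (suc n)) p t →
  lookup (removeAt xs p) t ≡ lookup xs (punchIn p t)
lookup-removeAt xs p t = begin
  lookup (removeAt xs p) t                                              ≡⟨ insertAt-punchIn (removeAt xs p) p (lookup xs p) t ⟨
  lookup (insertAt (removeAt xs p) p (lookup xs p)) (punchIn p t)       ≡⟨ cong (λ ys → lookup ys (punchIn p t)) (insertAt-removeAt xs p) ⟩
  lookup xs (punchIn p t)                                               ∎
  where open ≡-Reasoning

insertAt-removeAt′ : ∀ {A : Set} (xs : Vec A (suc n)) p {v} → v ≡ lookup xs p →
  insertAt (removeAt xs p) p v ≡ xs
insertAt-removeAt′ xs p refl = insertAt-removeAt xs p

argmin : (v : Fin (suc n) → ℕ) → ∃[ p ] (∀ q → v p ≤ v q)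
argmin {zero} v = Fin.zero , λ { Fin.zero → ≤-refl }
argmin {suc n} v with argmin (v ∘ Fin.suc)
... | p , p-min with v Fin.zero ≤ℕ? v (Fin.suc p)
...   | yes v₀≤ = Fin.zero , λ { Fin.zero → ≤-refl ; (Fin.suc q) → ≤-trans v₀≤ (p-min q) }
...   | no v₀≰ = Fin.suc p , λ { Fin.zero → <⇒≤ (≰⇒> v₀≰) ; (Fin.suc q) → p-min q }

module StrictlyIncreasing {f : ℕ → ℕ} (f-step : ∀ i → f i < f (suc i)) where

  <-mono : ∀ {i j} → i < j → f i < f j
  <-mono {i} {suc j} i<1+j with m<1+n⇒m<n∨m≡n i<1+j
  ... | inj₁ i<j = <-trans (<-mono i<j) (f-step j)
  ... | inj₂ refl = f-step i

  ≤-mono : ∀ {i j} → i ≤ j → f i ≤ f j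
  ≤-mono i≤j with m≤n⇒m<n∨m≡n i≤j
  ... | inj₁ i<j = <⇒≤ (<-mono i<j)
  ... | inj₂ refl = ≤-refl

  <-cancel : ∀ {i j} → f i < f j → i < j
  <-cancel fi<fj = ≰⇒> (λ j≤i → <⇒≱ fi<fj (≤-mono j≤i))

  ≤⇔≤ : ∀ i j → i ≤ j ⇔ f i ≤ f j
  ≤⇔≤ i j = mk⇔ ≤-mono (λ fi≤fj → ≮⇒≥ (λ j<i → <⇒≱ (<-mono j<i) fi≤fj))

  n≤f[n] : ∀ i → i ≤ f i
  n≤f[n] zero = z≤n
  n≤f[n] (suc i) = ≤-<-trans (n≤f[n] i) (f-step i)

Above : Pred ℕ 0ℓ → ℕ → Pred ℕ 0ℓ
Above W a b = W b × a < b

Infinite-above : ∀ {W} → Infinite W → ∀ a → Infinite (Above W a)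
Infinite-above W-inf a N with W-inf (N ⊔ suc a)
... | u , N⊔1+a≤u , u∈W = u , ≤-trans (m≤m⊔n N (suc a)) N⊔1+a≤u , u∈W , ≤-trans (m≤n⊔m N (suc a)) N⊔1+a≤u

module Enumeration {U : Pred ℕ 0ℓ} (U-inf : Infinite U) where

  enumerate : ℕ → ℕ
  enumerate zero = proj₁ (U-inf 0)
  enumerate (suc i) = proj₁ (U-inf (suc (enumerate i)))

  enumerate-∈ : ∀ i → enumerate i ∈ U
  enumerate-∈ zero = proj₂ (proj₂ (U-inf 0))
  enumerate-∈ (suc i) = proj₂ (proj₂ (U-inf (suc (enumerate i))))

  enumerate-step : ∀ i → enumerate i < enumerate (suc i)
  enumerate-step i = proj₁ (proj₂ (U-inf (suc (enumerate i))))

module Classical (lem : ExcludedMiddle 0ℓ) where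

  ¬Infinite⇒bounded : ∀ {P : Pred ℕ 0ℓ} → ¬ Infinite P → ∃[ N ] (∀ i → N ≤ i → ¬ P i)
  ¬Infinite⇒bounded {P} ¬inf with lem {∃[ N ] (∀ i → N ≤ i → ¬ P i)}
  ... | yes bounded = bounded
  ... | no ¬bounded = ⊥-elim (¬inf witness)
    where
    witness : Infinite P
    witness N with lem {∃[ i ] (N ≤ i × P i)}
    ... | yes found = found
    ... | no ¬found = ⊥-elim (¬bounded (N , λ i N≤i Pi → ¬found (i , N≤i , Pi)))

  Infinite-∪ : ∀ {P Q : Pred ℕ 0ℓ} → Infinite (P ∪ Q) → Infinite P ⊎ Infinite Q
  Infinite-∪ {P} {Q} PQ-inf with lem {Infinite P}
  ... | yes P-inf = inj₁ P-inf
  ... | no ¬P-inf = inj₂ Q-inf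
    where
    Q-inf : Infinite Q
    Q-inf N with ¬Infinite⇒bounded ¬P-inf
    ... | B , ¬P with PQ-inf (N ⊔ B)
    ...   | u , N⊔B≤u , inj₁ Pu = ⊥-elim (¬P u (≤-trans (m≤n⊔m N B) N⊔B≤u) Pu)
    ...   | u , N⊔B≤u , inj₂ Qu = u , ≤-trans (m≤m⊔n N B) N⊔B≤u , Qu

  Infinite-∃-Fin : (P : Fin k → Pred ℕ 0ℓ) → Infinite (λ i → ∃[ c ] P c i) → ∃[ c ] Infinite (P c)
  Infinite-∃-Fin {zero} P inf with inf 0
  ... | _ , _ , () , _
  Infinite-∃-Fin {suc k} P inf with Infinite-∪ split-inf
    where
    split-inf : Infinite (P Fin.zero ∪ (λ i → ∃[ c ] P (Fin.suc c) i))
    split-inf N with inf N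
    ... | u , N≤u , Fin.zero , Pu = u , N≤u , inj₁ Pu
    ... | u , N≤u , Fin.suc c , Pu = u , N≤u , inj₂ (c , Pu)
  ... | inj₁ P₀-inf = Fin.zero , P₀-inf
  ... | inj₂ rest-inf with Infinite-∃-Fin (P ∘ Fin.suc) rest-inf
  ...   | c , Pc-inf = Fin.suc c , Pc-inf

  infinite-pigeonhole : (g : ℕ → Fin k) → ∃[ c ] Infinite (λ i → g i ≡ c)
  infinite-pigeonhole g = Infinite-∃-Fin (λ c i → g i ≡ c) (λ N → N , ≤-refl , g N , refl)

ValuesIn : Pred ℕ 0ℓ → Map n m → Set
ValuesIn U x = ∀ i → π₀ (lookup x i) ∈ U

-- Like tp, but with the level of each point in place of the level counts, which
-- determine the levels only for embeddings.
SameShape : Map n m → Map n m → Set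
SameShape x y = (∀ i j → π₀ (lookup x i) ≤ π₀ (lookup x j) ⇔ π₀ (lookup y i) ≤ π₀ (lookup y j))
              × (∀ i → π₁ (lookup x i) ≡ π₁ (lookup y i))

ValuesIn-removeAt : ∀ {U} (x : Map (suc n) m) p → ValuesIn U x → ValuesIn U (removeAt x p)
ValuesIn-removeAt {U = U} x p x∈U t = subst (λ v → π₀ v ∈ U) (sym (lookup-removeAt x p t)) (x∈U (punchIn p t))

SameShape-removeAt : ∀ (x y : Map (suc n) m) p → SameShape x y → SameShape (removeAt x p) (removeAt y p)
SameShape-removeAt x y p (order , level) = order′ , level′
  where
  order′ : ∀ i j → π₀ (lookup (removeAt x p) i) ≤ π₀ (lookup (removeAt x p) j)
                  ⇔ π₀ (lookup (removeAt y p) i) ≤ π₀ (lookup (removeAt y p) j)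
  order′ i j rewrite lookup-removeAt x p i | lookup-removeAt x p j
                   | lookup-removeAt y p i | lookup-removeAt y p j = order (punchIn p i) (punchIn p j)
  level′ : ∀ i → π₁ (lookup (removeAt x p) i) ≡ π₁ (lookup (removeAt y p) i)
  level′ i rewrite lookup-removeAt x p i | lookup-removeAt y p i = level (punchIn p i)

liftΩ : (ℕ → ℕ) → Ωm m → Ωm m
liftΩ f (a , ℓ) = f a , ℓ

module _ {f : ℕ → ℕ} (f-≤ : ∀ a b → a ≤ b ⇔ f a ≤ f b) where

  liftΩ-≤ω : (x y : Ωm m) → x ≤ω y ⇔ liftΩ f x ≤ω liftΩ f y
  liftΩ-≤ω x@(a , _) y@(b , _) = mk⇔ forth back
    where
    forth : x ≤ω y → liftΩ f x ≤ω liftΩ f y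
    forth (inj₁ ℓ<ℓ′) = inj₁ ℓ<ℓ′
    forth (inj₂ (ℓ≡ℓ′ , a≤b)) = inj₂ (ℓ≡ℓ′ , to (f-≤ a b) a≤b)
    back : liftΩ f x ≤ω liftΩ f y → x ≤ω y
    back (inj₁ ℓ<ℓ′) = inj₁ ℓ<ℓ′
    back (inj₂ (ℓ≡ℓ′ , fa≤fb)) = inj₂ (ℓ≡ℓ′ , from (f-≤ a b) fa≤fb)

  IsEmb-map-liftΩ : (g : Map n m) → IsEmb g → IsEmb (map (liftΩ f) g)
  IsEmb-map-liftΩ g g-emb i j rewrite lookup-map i (liftΩ f) g | lookup-map j (liftΩ f) g =
    mk⇔ (to (liftΩ-≤ω _ _) ∘ to (g-emb i j)) (from (g-emb i j) ∘ from (liftΩ-≤ω _ _))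

  tp-map-liftΩ : (g : Map n m) → tp (map (liftΩ f) g) ≡ tp g
  tp-map-liftΩ g = cong₂ _,_
    (tabulate-cong λ ℓ → count-map (λ x → π₁ x ≟ᶠ ℓ) (liftΩ f) g)
    (tabulate-cong λ i → tabulate-cong λ j → order-entry i j)
    where
    order-entry : ∀ i j → ⌊ π₀ (lookup (map (liftΩ f) g) i) ≤ℕ? π₀ (lookup (map (liftΩ f) g) j) ⌋
                        ≡ ⌊ π₀ (lookup g i) ≤ℕ? π₀ (lookup g j) ⌋
    order-entry i j rewrite lookup-map i (liftΩ f) g | lookup-map j (liftΩ f) g =
      sym (⇔⇒⌊⌋-≡ _ _ (f-≤ _ _))

Embτ-nonempty : ∀ {U} {τ : MultType n m} → Infinite U → IsMultType τ → ∃[ f ] InEmbτU τ U f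
Embτ-nonempty {U = U} U-inf (g , g-emb , tp-g) =
  map (liftΩ enumerate) g , IsEmb-map-liftΩ ≤⇔≤ g g-emb , trans (tp-map-liftΩ ≤⇔≤ g) tp-g , values
  where
  open Enumeration U-inf
  open StrictlyIncreasing enumerate-step
  values : ∀ i → π₀ (lookup (map (liftΩ enumerate) g) i) ∈ U
  values i rewrite lookup-map i (liftΩ enumerate) g = enumerate-∈ (π₀ (lookup g i))

levelCount : Fin m → Map n m → ℕ
levelCount ℓ = count (λ x → π₁ x ≟ᶠ ℓ)

IsEmb-tail : ∀ (x : Ωm m) (xs : Map n m) → IsEmb (x ∷ xs) → IsEmb xs
IsEmb-tail x xs emb i j =
  mk⇔ (λ i≤j → to (emb (Fin.suc i) (Fin.suc j)) (s≤s i≤j)) (≤-pred ∘ from (emb (Fin.suc i) (Fin.suc j)))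

IsEmb-head-level-min : ∀ (x : Ωm m) (xs : Map n m) → IsEmb (x ∷ xs) →
  ∀ j → toℕ (π₁ x) ≤ toℕ (π₁ (lookup xs j))
IsEmb-head-level-min x xs emb j with to (emb Fin.zero (Fin.suc j)) z≤n
... | inj₁ ℓ<ℓ′ = <⇒≤ ℓ<ℓ′
... | inj₂ (ℓ≡ℓ′ , _) = ≤-reflexive (cong toℕ ℓ≡ℓ′)

levelCount-below : ∀ (ℓ : Fin m) (xs : Map n m) → (∀ j → toℕ ℓ < toℕ (π₁ (lookup xs j))) → levelCount ℓ xs ≡ 0
levelCount-below ℓ [] _ = refl
levelCount-below ℓ (x ∷ xs) above with π₁ x ≟ᶠ ℓ
... | yes refl = ⊥-elim (<-irrefl refl (above Fin.zero))
... | no _ = levelCount-below ℓ xs (above ∘ Fin.suc)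

levelCount-head : ∀ (x : Ωm m) (xs : Map n m) → levelCount (π₁ x) (x ∷ xs) ≡ suc (levelCount (π₁ x) xs)
levelCount-head x xs with π₁ x ≟ᶠ π₁ x
... | yes _ = refl
... | no ℓ≢ℓ = ⊥-elim (ℓ≢ℓ refl)

levelCount-tail : ∀ (x y : Ωm m) (xs ys : Map n m) → π₁ x ≡ π₁ y → ∀ ℓ →
  levelCount ℓ (x ∷ xs) ≡ levelCount ℓ (y ∷ ys) → levelCount ℓ xs ≡ levelCount ℓ ys
levelCount-tail x y xs ys x≡y ℓ eq with π₁ x ≟ᶠ ℓ | π₁ y ≟ᶠ ℓ
... | yes _ | yes _ = suc-injective eq
... | no _ | no _ = eq
... | yes x≡ℓ | no y≢ℓ = ⊥-elim (y≢ℓ (trans (sym x≡y) x≡ℓ))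
... | no x≢ℓ | yes y≡ℓ = ⊥-elim (x≢ℓ (trans x≡y y≡ℓ))

head-level-≮ : ∀ (x y : Ωm m) (xs ys : Map n m) → IsEmb (y ∷ ys) →
  levelCount (π₁ x) (x ∷ xs) ≡ levelCount (π₁ x) (y ∷ ys) → toℕ (π₁ x) ≮ toℕ (π₁ y)
head-level-≮ x y xs ys emb eq x<y = 1+n≢0 (begin
  suc (levelCount (π₁ x) xs)   ≡⟨ levelCount-head x xs ⟨
  levelCount (π₁ x) (x ∷ xs)   ≡⟨ eq ⟩
  levelCount (π₁ x) (y ∷ ys)   ≡⟨ levelCount-below (π₁ x) (y ∷ ys) above ⟩
  0                            ∎)
  where
  open ≡-Reasoning
  above : ∀ j → toℕ (π₁ x) < toℕ (π₁ (lookup (y ∷ ys) j))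
  above Fin.zero = x<y
  above (Fin.suc j) = <-≤-trans x<y (IsEmb-head-level-min y ys emb j)

levels-≡ : ∀ (f g : Map n m) → IsEmb f → IsEmb g → (∀ ℓ → levelCount ℓ f ≡ levelCount ℓ g) →
  ∀ i → π₁ (lookup f i) ≡ π₁ (lookup g i)
levels-≡ (x ∷ xs) (y ∷ ys) x-emb y-emb counts = levels
  where
  head-≡ : π₁ x ≡ π₁ y
  head-≡ with <-cmp (toℕ (π₁ x)) (toℕ (π₁ y))
  ... | tri< x<y _ _ = ⊥-elim (head-level-≮ x y xs ys y-emb (counts (π₁ x)) x<y)
  ... | tri≈ _ x≡y _ = toℕ-injective x≡y
  ... | tri> _ _ y<x = ⊥-elim (head-level-≮ y x ys xs x-emb (sym (counts (π₁ y))) y<x)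
  levels : ∀ i → π₁ (lookup (x ∷ xs) i) ≡ π₁ (lookup (y ∷ ys) i)
  levels Fin.zero = head-≡
  levels (Fin.suc i) = levels-≡ xs ys (IsEmb-tail x xs x-emb) (IsEmb-tail y ys y-emb)
    (λ ℓ → levelCount-tail x y xs ys head-≡ ℓ (counts ℓ)) i

tp-≡⇒SameShape : ∀ (f g : Map n m) → IsEmb f → IsEmb g → tp f ≡ tp g → SameShape f g
tp-≡⇒SameShape f g f-emb g-emb tp-≡ = orders , levels-≡ f g f-emb g-emb counts
  where
  order-entry : ∀ (h : Map n m) i j → lookup (lookup (proj₂ (tp h)) i) j ≡ ⌊ π₀ (lookup h i) ≤ℕ? π₀ (lookup h j) ⌋
  order-entry h i j = trans (cong (λ row → lookup row j) (lookup∘tabulate _ i)) (lookup∘tabulate _ j)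
  orders : ∀ i j → π₀ (lookup f i) ≤ π₀ (lookup f j) ⇔ π₀ (lookup g i) ≤ π₀ (lookup g j)
  orders i j = ⌊⌋-≡⇒⇔ _ _ (begin
    ⌊ π₀ (lookup f i) ≤ℕ? π₀ (lookup f j) ⌋  ≡⟨ order-entry f i j ⟨
    lookup (lookup (proj₂ (tp f)) i) j       ≡⟨ cong (λ τ → lookup (lookup (proj₂ τ) i) j) tp-≡ ⟩
    lookup (lookup (proj₂ (tp g)) i) j       ≡⟨ order-entry g i j ⟩
    ⌊ π₀ (lookup g i) ≤ℕ? π₀ (lookup g j) ⌋  ∎)
    where open ≡-Reasoning
  counts : ∀ ℓ → levelCount ℓ f ≡ levelCount ℓ g
  counts ℓ = begin
    levelCount ℓ f            ≡⟨ lookup∘tabulate _ ℓ ⟨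
    lookup (proj₁ (tp f)) ℓ   ≡⟨ cong (λ τ → lookup (proj₁ τ) ℓ) tp-≡ ⟩
    lookup (proj₁ (tp g)) ℓ   ≡⟨ lookup∘tabulate _ ℓ ⟩
    levelCount ℓ g            ∎
    where open ≡-Reasoning

Homogeneous : (Map n m → Fin k) → Pred ℕ 0ℓ → Map n m → Fin k → Set
Homogeneous χ U z c = ∀ x → ValuesIn U x → SameShape x z → χ x ≡ c

HasHomogeneousSubsets : ℕ → Map n m → Set₁
HasHomogeneousSubsets {n} {m} k z = (χ : Map n m → Fin k) (V : Pred ℕ 0ℓ) → Infinite V →
  ∃[ U ] (Infinite U × U ⊆ V × ∃[ c ] Homogeneous χ U z c)

-- A point of z sharing its first coordinate with another point q is recovered from q.
HasHomogeneousSubsets-tie : ∀ (z : Map (suc n) m) p q (q≢p : q ≢ p) →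
  π₀ (lookup z q) ≡ π₀ (lookup z p) → HasHomogeneousSubsets k (removeAt z p) → HasHomogeneousSubsets k z
HasHomogeneousSubsets-tie {n = n} {m = m} z p q q≢p tie removed χ V V-inf =
  let U , U-inf , U⊆V , c , homogeneous = removed (χ ∘ restore) V V-inf in
  U , U-inf , U⊆V , c , λ x x∈U x~z → begin
    χ x                         ≡⟨ cong χ (restore-removeAt x x~z) ⟨
    χ (restore (removeAt x p))  ≡⟨ homogeneous (removeAt x p) (ValuesIn-removeAt {U = U} x p x∈U)
                                                (SameShape-removeAt x z p x~z) ⟩
    c                           ∎
  where
  open ≡-Reasoning
  p≢q : p ≢ q
  p≢q = q≢p ∘ sym
  restore : Map n m → Map (suc n) m
  restore y = insertAt y p (π₀ (lookup y (punchOut p≢q)) , π₁ (lookup z p))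
  restore-removeAt : ∀ x → SameShape x z → restore (removeAt x p) ≡ x
  restore-removeAt x (order , level) = insertAt-removeAt′ x p (cong₂ _,_ x₀[q]≡x₀[p] (sym (level p)))
    where
    x₀[q]≡x₀[p] : π₀ (lookup (removeAt x p) (punchOut p≢q)) ≡ π₀ (lookup x p)
    x₀[q]≡x₀[p] rewrite removeAt-punchOut x p≢q =
      ≤-antisym (from (order q p) (≤-reflexive tie)) (from (order p q) (≤-reflexive (sym tie)))

module Diagonal (lem : ExcludedMiddle 0ℓ) (z : Map (suc n) m) (p : Fin (suc n))
  (p-strict-min : ∀ q → q ≢ p → π₀ (lookup z p) < π₀ (lookup z q))
  (removed : HasHomogeneousSubsets k (removeAt z p))
  (χ : Map (suc n) m → Fin k) (V : Pred ℕ 0ℓ) (V-inf : Infinite V) where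

  open Classical lem

  χ[_] : ℕ → Map n m → Fin k
  χ[ a ] y = χ (insertAt y p (a , π₁ (lookup z p)))

  Stage : Set₁
  Stage = Σ (Pred ℕ 0ℓ) Infinite

  least : Stage → ℕ
  least (_ , W-inf) = proj₁ (W-inf 0)

  refine : (s : Stage) → ∃[ U ] (Infinite U × U ⊆ Above (proj₁ s) (least s) ×
                                  ∃[ c ] Homogeneous χ[ least s ] U (removeAt z p) c)
  refine s@(W , W-inf) = removed χ[ least s ] (Above W (least s)) (Infinite-above W-inf (least s))

  stage : ℕ → Stage
  stage zero = V , V-inf
  stage (suc i) = proj₁ (refine (stage i)) , proj₁ (proj₂ (refine (stage i)))

  W : ℕ → Pred ℕ 0ℓ
  W i = proj₁ (stage i)

  a : ℕ → ℕ
  a i = least (stage i)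

  colour : ℕ → Fin k
  colour i = proj₁ (proj₂ (proj₂ (proj₂ (refine (stage i)))))

  a∈W : ∀ i → a i ∈ W i
  a∈W i = proj₂ (proj₂ (proj₂ (stage i) 0))

  W-suc⊆ : ∀ i → W (suc i) ⊆ Above (W i) (a i)
  W-suc⊆ i = proj₁ (proj₂ (proj₂ (refine (stage i))))

  W-homogeneous : ∀ i → Homogeneous χ[ a i ] (W (suc i)) (removeAt z p) (colour i)
  W-homogeneous i = proj₂ (proj₂ (proj₂ (proj₂ (refine (stage i)))))

  W-antitone : ∀ {i j} → i ≤ j → W j ⊆ W i
  W-antitone {i} {j} i≤j with m≤n⇒m<n∨m≡n i≤j
  W-antitone {i} {suc j} _ | inj₁ i<1+j = W-antitone {i} {j} (≤-pred i<1+j) ∘ proj₁ ∘ W-suc⊆ j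
  ... | inj₂ refl = id

  a-later : ∀ {i j} → i < j → a j ∈ W (suc i)
  a-later {j = j} i<j = W-antitone i<j (a∈W j)

  open StrictlyIncreasing {a} (λ i → proj₂ (W-suc⊆ i (a∈W (suc i))))

  col : Fin k
  col = proj₁ (infinite-pigeonhole colour)

  U : Pred ℕ 0ℓ
  U b = ∃[ i ] (a i ≡ b × colour i ≡ col)

  U-inf : Infinite U
  U-inf N with proj₂ (infinite-pigeonhole colour) N
  ... | i , N≤i , colour≡ = a i , ≤-trans N≤i (n≤f[n] i) , i , refl , colour≡

  U⊆V : U ⊆ V
  U⊆V (i , refl , _) = W-antitone {0} {i} z≤n (a∈W i)

  U-homogeneous : Homogeneous χ U z col
  U-homogeneous x x∈U x~z with x∈U p
  ... | i , a[i]≡x[p] , colour≡ = begin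
    χ x                        ≡⟨ cong χ (insertAt-removeAt′ x p (cong₂ _,_ a[i]≡x[p] (sym (proj₂ x~z p)))) ⟨
    χ[ a i ] (removeAt x p)    ≡⟨ W-homogeneous i (removeAt x p) rest∈W (SameShape-removeAt x z p x~z) ⟩
    colour i                   ≡⟨ colour≡ ⟩
    col                        ∎
    where
    open ≡-Reasoning
    rest∈W : ValuesIn (W (suc i)) (removeAt x p)
    rest∈W t rewrite lookup-removeAt x p t with x∈U (punchIn p t)
    ... | j , a[j]≡x[q] , _ = subst (W (suc i)) a[j]≡x[q] (a-later {i} {j} (<-cancel a[i]<a[j]))
      where
      x[p]<x[q] : π₀ (lookup x p) < π₀ (lookup x (punchIn p t))
      x[p]<x[q] = ≰⇒> λ x[q]≤x[p] →
        <⇒≱ (p-strict-min (punchIn p t) (punchInᵢ≢i p t)) (to (proj₁ x~z (punchIn p t) p) x[q]≤x[p])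
      a[i]<a[j] : a i < a j
      a[i]<a[j] = subst₂ _<_ (sym a[i]≡x[p]) (sym a[j]≡x[q]) x[p]<x[q]

  homogeneous-subset : ∃[ U ] (Infinite U × U ⊆ V × ∃[ c ] Homogeneous χ U z c)
  homogeneous-subset = U , U-inf , U⊆V , col , U-homogeneous

homogeneous-subsets : ExcludedMiddle 0ℓ → (z : Map n m) → HasHomogeneousSubsets k z
homogeneous-subsets lem [] χ V V-inf = V , V-inf , id , χ [] , λ { [] _ _ → refl }
homogeneous-subsets lem z@(_ ∷ _) with argmin (π₀ ∘ lookup z)
... | p , p-min with any? (λ q → ¬? (q ≟ᶠ p) ×-dec (π₀ (lookup z q) ≟ℕ π₀ (lookup z p)))
...   | yes (q , q≢p , tie) = HasHomogeneousSubsets-tie z p q q≢p tie (homogeneous-subsets lem (removeAt z p))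
...   | no ¬tie = Diagonal.homogeneous-subset lem z p p-strict-min (homogeneous-subsets lem (removeAt z p))
  where
  p-strict-min : ∀ q → q ≢ p → π₀ (lookup z p) < π₀ (lookup z q)
  p-strict-min q q≢p = ≤∧≢⇒< (p-min q) (λ tie → ¬tie (q , q≢p , sym tie))

corollary4p6 : ExcludedMiddle 0ℓ →
    (n m : ℕ) → n ≥ 1 → m ≥ 1 →
    (τ : MultType n m) → IsMultType τ →
    (k : ℕ) → k ≥ 2 →
    (χ : Map n m → Fin k) →
    ∃[ U ] (Infinite U × ∃[ c ] ((∃[ f ] InEmbτU τ U f) × (∀ (f : Map n m) → InEmbτU τ U f → χ f ≡ c)))
corollary4p6 lem n m _ _ τ τ-type@(f₀ , f₀-emb , tp-f₀) k _ χ
  with homogeneous-subsets lem f₀ χ (λ _ → ⊤) (λ N → N , ≤-refl , tt)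
... | U , U-inf , _ , c , homogeneous =
  U , U-inf , c , Embτ-nonempty U-inf τ-type ,
  λ f (f-emb , tp-f , f∈U) → homogeneous f f∈U (tp-≡⇒SameShape f f₀ f-emb f₀-emb (trans tp-f (sym tp-f₀)))
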